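{- Let $(N_1,m_1)\vartriangleright_E(N_2,m_2)$ with both marked nets safe, let $G$ be a well-formed TFG for this equivalence, and let $\mathcal{C}$ be the concurrency relation of $G$; write $v\,\bar{\mathcal{C}}\,w$ for $\neg(v\,\mathcal{C}\,w)$. Let $v$ be a node of $G$ such that $v\mathbin{\circ\!\to} X$ or $X\mathbin{\to\!\bullet} v$. Then for all $w,w'\in X$ with $w\neq w'$ we have $w\,\bar{\mathcal{C}}\,w'$.
   Context: A Petri net $N=(P,T,\mathrm{Pre},\mathrm{Post})$ has a finite set of places $P$, a finite set of transitions $T$, and flow functions $\mathrm{Pre},\mathrm{Post}:T\to(P\to\mathbb{N})$. A marking is $m:P\to\mathbb{N}$; $t$ is enabled at $m$ if $m\ge\mathrm{Pre}(t)$, and firing gives $m-\mathrm{Pre}(t)+\mathrm{Post}(t)$. $R(N,m_0)$ is the set of markings reachable from $m_0$ by finite (possibly empty) firing sequences. $(N,m_0)$ is safe if every reachable marking has at most one token in each place. Linear systems: $E$ is a finite collection of equations $x=y_1+\dots+y_l$, with variable set $\mathrm{fv}(E)$; solutions are non-negative integer; consistent means having a solution. For a partial map $c$ defined exactly on $v_1,\dots,v_k$, $[c]$ is the system $v_1=c(v_1),\dots,v_k=c(v_k)$; commas denote union. $E$-equivalence: $(N_1,m_1)\vartriangleright_E(N_2,m_2)$ (place sets $P_1,P_2$) iff (A1) $E,[m]$ consistent for every $m\in R(N_1,m_1)\cup R(N_2,m_2)$; (A2) $E,[m_1],[m_2]$ consistent; (A3) for all markings $m_1'$ of $N_1$, $m_2'$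 of $N_2$ with $E,[m_1'],[m_2']$ consistent, $m_1'\in R(N_1,m_1)\iff m_2'\in R(N_2,m_2)$. TFGs: fix pairwise disjoint sets $K(n)$, $n\in\mathbb{N}$, of constant nodes of value $n$, disjoint from place/variable names; $K=\bigcup_nK(n)$. A TFG with places $P$ is $(V,R,A)$, $V=P\cup S$ with $S\subset K$ finite, $R,A\subseteq V\times V$ disjoint; $v\mathbin{\to\!\bullet} w$ iff $(v,w)\in R$, $v\mathbin{\circ\!\to} w$ iff $(v,w)\in A$, $v\to w$ for either. Roots have no incoming arc; $\circ$-leaves have no outgoing $A$-arc. $v\mathbin{\circ\!\to} X$: $X$ is the nonempty set of all $A$-successors of $v$; $X\mathbin{\to\!\bullet} v$: $X$ is the nonempty set of all $R$-predecessors of $v$. Well-formed TFG for $(N_1,m_1)\vartriangleright_E(N_2,m_2)$: (T1) $V\setminus K=P_1\cup P_2\cup\mathrm{fv}(E)$; (T2) nodes in $V\cap K$ are roots; (T3) not both $p\mathbin{\circ\!\to} q$ and $p'\to q$ with $p\ne p'$, and not both $p\mathbin{\to\!\bullet} q$ and $p\mathbin{\circ\!\to} q$; (T4) $v\mathbin{\circ\!\to} X$ or $X\mathbin{\to\!\bullet} v$ iff the equation $v=\sum_{x\in X}x$ is in $E$; (T5) acyclic; (T6) roots not in $K$ are exactly $P_2$, $\circ$-leaves not in $K$ exactly $P_1$. A configuration is a partial $c:V\to\mathbb{N}$ ($\bot$ where undefined) with $c(v)=n$ for $v\in V\cap K(n)$; total if defined everywhere; $c_{|N}$ is its restriction to the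 places of $N$. $c$ is well-defined if (CBot) whenever $v\to w$, $c(v)=\bot\iff c(w)=\bot$; (CEq) whenever $c(v)\ne\bot$ and ($v\mathbin{\circ\!\to} X$ or $X\mathbin{\to\!\bullet} v$), $c(v)=\sum_{x\in X}c(x)$. The concurrency relation $\mathcal{C}$ of $G$: $v\,\mathcal{C}\,w$ iff there is a total, well-defined configuration $c$ with $c_{|N_2}\in R(N_2,m_2)$, $c(v)>0$ and $c(w)>0$. -}

module Defs where

open import Data.Nat using (ℕ; zero; suc; _+_; _∸_; _≤_)
open import Data.Fin using (Fin)
open import Data.List using (List; []; _∷_; _++_; map)
open import Data.Nat.ListAction using (sum)
open import Data.List.Membership.Propositional using (_∈_; _∉_)
open import Data.List.Relation.Unary.Unique.Propositional using (Unique)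
open import Data.Maybe using (Maybe; just; nothing; fromMaybe)
open import Data.Product using (Σ; ∃; _×_; _,_)
open import Data.Sum using (_⊎_)
open import Relation.Binary.PropositionalEquality using (_≡_; _≢_)
open import Relation.Nullary using (¬_)
open import Data.Empty using (⊥)

Name : Set
Name = ℕ

-- A node is either a name (place/variable) or a constant node.
-- `cst n i` is the i-th constant node of value n, so K(n) = { cst n i | i }.
data Node : Set where
  var : Name → Node
  cst : ℕ → ℕ → Node

-- A marking assigns a number of tokens to each name; only the values on
-- the places of the net are ever observed.
Marking : Set
Marking = Name → ℕ

record Net : Set where
  field
    places : List Name
    #trans : ℕ
    pre    : Fin #trans → Name → ℕ
    post   : Fin #trans → Name → ℕ
open Net public

_≈[_]_ : Marking → Net → Marking → Set
m ≈[ N ] m' = ∀ p → p ∈ places N → m p ≡ m' p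

Enabled : (N : Net) → Marking → Fin (#trans N) → Set
Enabled N m t = ∀ p → p ∈ places N → pre N t p ≤ m p

fire : (N : Net) → Marking → Fin (#trans N) → Marking
fire N m t p = m p ∸ pre N t p + post N t p

data Fires (N : Net) (m0 : Marking) : Marking → Set where
  done : Fires N m0 m0
  step : ∀ {m} → Fires N m0 m → (t : Fin (#trans N)) → Enabled N m t →
         Fires N m0 (fire N m t)

Reach : (N : Net) → Marking → Marking → Set
Reach N m0 m = ∃ λ m' → Fires N m0 m' × (m' ≈[ N ] m)

Safe : Net → Marking → Set
Safe N m0 = ∀ m → Reach N m0 m → ∀ p → p ∈ places N → m p ≤ 1

-- An equation  x = y1 + ... + yl ; terms are nodes (names, or constant
-- nodes standing for their value).
record Equation : Set where
  constructor _≐_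
  field
    lhs : Node
    rhs : List Node
open Equation public

LinSys : Set
LinSys = List Equation

InFV : LinSys → Name → Set
InFV E n = ∃ λ e → e ∈ E × (lhs e ≡ var n ⊎ var n ∈ rhs e)

Valuation : Set
Valuation = Name → ℕ

val : Valuation → Node → ℕ
val s (var n)   = s n
val s (cst k _) = k

Solves : LinSys → Valuation → Set
Solves E s = ∀ e → e ∈ E → val s (lhs e) ≡ sum (map (val s) (rhs e))

-- s satisfies the system [m] for m a marking of net N (domain = places N)
Agrees : Net → Marking → Valuation → Set
Agrees N m s = ∀ p → p ∈ places N → s p ≡ m p

Consistent₁ : LinSys → Net → Marking → Set
Consistent₁ E N m = ∃ λ s → Solves E s × Agrees N m s

Consistent₂ : LinSys → Net → Marking → Net → Marking → Set
Consistent₂ E N₁ m₁ N₂ m₂ = ∃ λ s → Solves E s × Agrees N₁ m₁ s × Agrees N₂ m₂ s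

record Equiv (N₁ : Net) (m₁ : Marking) (E : LinSys) (N₂ : Net) (m₂ : Marking) : Set where
  field
    A1₁ : ∀ m → Reach N₁ m₁ m → Consistent₁ E N₁ m
    A1₂ : ∀ m → Reach N₂ m₂ m → Consistent₁ E N₂ m
    A2  : Consistent₂ E N₁ m₁ N₂ m₂
    A3  : ∀ m₁' m₂' → Consistent₂ E N₁ m₁' N₂ m₂' →
          (Reach N₁ m₁ m₁' → Reach N₂ m₂ m₂') × (Reach N₂ m₂ m₂' → Reach N₁ m₁ m₁')

record TFG : Set where
  field
    nodes : List Node
    Rarcs : List (Node × Node)
    Aarcs : List (Node × Node)
open TFG public

_⊢_→•_ : TFG → Node → Node → Set
G ⊢ v →• w = (v , w) ∈ Rarcs G

_⊢_∘→_ : TFG → Node → Node → Set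
G ⊢ v ∘→ w = (v , w) ∈ Aarcs G

_⊢_⟶_ : TFG → Node → Node → Set
G ⊢ v ⟶ w = G ⊢ v →• w ⊎ G ⊢ v ∘→ w

IsRoot : TFG → Node → Set
IsRoot G v = ∀ u → ¬ (G ⊢ u ⟶ v)

IsALeaf : TFG → Node → Set
IsALeaf G v = ∀ u → ¬ (G ⊢ v ∘→ u)

data Path⁺ (G : TFG) : Node → Node → Set where
  one  : ∀ {u w} → G ⊢ u ⟶ w → Path⁺ G u w
  cons : ∀ {u v w} → G ⊢ u ⟶ v → Path⁺ G v w → Path⁺ G u w

data NonEmpty {A : Set} : List A → Set where
  nonEmpty : ∀ {x xs} → NonEmpty (x ∷ xs)

IsASuccs : TFG → Node → List Node → Set
IsASuccs G v xs = ∀ x → (x ∈ xs → G ⊢ v ∘→ x) × (G ⊢ v ∘→ x → x ∈ xs)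

IsRPreds : TFG → Node → List Node → Set
IsRPreds G v xs = ∀ x → (x ∈ xs → G ⊢ x →• v) × (G ⊢ x →• v → x ∈ xs)

record WellFormed (N₁ : Net) (E : LinSys) (N₂ : Net) (G : TFG) : Set where
  field
    R⊆V     : ∀ v w → G ⊢ v →• w → v ∈ nodes G × w ∈ nodes G
    A⊆V     : ∀ v w → G ⊢ v ∘→ w → v ∈ nodes G × w ∈ nodes G
    disjRA  : ∀ v w → G ⊢ v →• w → G ⊢ v ∘→ w → ⊥
    T1      : ∀ n → (var n ∈ nodes G → n ∈ places N₁ ⊎ n ∈ places N₂ ⊎ InFV E n)
                  × (n ∈ places N₁ ⊎ n ∈ places N₂ ⊎ InFV E n → var n ∈ nodes G)
    T2      : ∀ k i → cst k i ∈ nodes G → IsRoot G (cst k i)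
    T3a     : ∀ p p' q → G ⊢ p ∘→ q → G ⊢ p' ⟶ q → p ≡ p'
    T3b     : ∀ p q → G ⊢ p →• q → G ⊢ p ∘→ q → ⊥
    T4A     : ∀ v x → G ⊢ v ∘→ x → ∃ λ xs → (v ≐ xs) ∈ E × Unique xs × IsASuccs G v xs
    T4R     : ∀ v x → G ⊢ x →• v → ∃ λ xs → (v ≐ xs) ∈ E × Unique xs × IsRPreds G v xs
    T4E     : ∀ e → e ∈ E → NonEmpty (rhs e) × Unique (rhs e) ×
                (IsASuccs G (lhs e) (rhs e) ⊎ IsRPreds G (lhs e) (rhs e))
    T5      : ∀ v → ¬ Path⁺ G v v
    T6root  : ∀ n → (var n ∈ nodes G × IsRoot G (var n) → n ∈ places N₂)
                  × (n ∈ places N₂ → var n ∈ nodes G × IsRoot G (var n))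
    T6leaf  : ∀ n → (var n ∈ nodes G × IsALeaf G (var n) → n ∈ places N₁)
                  × (n ∈ places N₁ → var n ∈ nodes G × IsALeaf G (var n))

Config : Set
Config = Node → Maybe ℕ

sumC : Config → List Node → Maybe ℕ
sumC c []       = just 0
sumC c (x ∷ xs) with c x | sumC c xs
... | just a | just b = just (a + b)
... | _      | _      = nothing

IsConfig : TFG → Config → Set
IsConfig G c = ∀ k i → cst k i ∈ nodes G → c (cst k i) ≡ just k

Total : TFG → Config → Set
Total G c = ∀ v → v ∈ nodes G → c v ≢ nothing

record WellDefined (G : TFG) (c : Config) : Set where
  field
    CBot  : ∀ v w → G ⊢ v ⟶ w → (c v ≡ nothing → c w ≡ nothing) × (c w ≡ nothing → c v ≡ nothing)
    CEqA  : ∀ v n xs → c v ≡ just n → NonEmpty xs → Unique xs → IsASuccs G v xs → sumC c xs ≡ just n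
    CEqR  : ∀ v n xs → c v ≡ just n → NonEmpty xs → Unique xs → IsRPreds G v xs → sumC c xs ≡ just n

restrict : Config → Marking
restrict c p = fromMaybe 0 (c (var p))

Positive : Config → Node → Set
Positive c v = ∃ λ k → c v ≡ just (suc k)

Conc : TFG → Net → Marking → Node → Node → Set
Conc G N₂ m₂ v w = ∃ λ c → IsConfig G c × Total G c × WellDefined G c ×
                   Reach N₂ m₂ (restrict c) × Positive c v × Positive c w

{-# OPTIONS --safe #-}
-- A total well-defined configuration c is a solution s of E whose restriction to N₂ is
-- reachable, and the two positive siblings w, w' force s(v) ≥ 2. Every solution can be
-- rerouted at a node u: u sends all its tokens to its first A-child, every node whose inflow
-- has changed forwards everything to its first A-child, and all other nodes keep their value.
-- The result is again a solution and it agrees with s on the roots, hence on N₂ and on the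
-- constants. Rerouting repeatedly carries the value s(v) along A-arcs down to an A-leaf, which
-- is a place of N₁; by (A3) the resulting marking of N₁ is reachable, so safety of N₁ bounds
-- that value by 1.

module Submission where

open import Defs
open import Data.Bool using (if_then_else_)
open import Data.Empty using (⊥; ⊥-elim)
open import Data.List using (List; []; _∷_; length; map)
open import Data.List.Membership.Propositional using (_∈_; _∉_; _─_; find; lose; mapWith∈)
open import Data.List.Membership.Propositional.Properties using (mapWith∈-cong; mapWith∈≗map)
open import Data.List.Membership.Propositional.Properties.WithK using (unique∧set⇒bag)
open import Data.List.Properties using (length-removeAt′; map-cong-local)
open import Data.List.Relation.Binary.BagAndSetEquality using (∼bag⇒↭)
open import Data.List.Relation.Binary.Permutation.Propositional.Properties using (map⁺)
open import Data.List.Relation.Unary.All using (All; []; _∷_)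
import Data.List.Relation.Unary.All as All
open import Data.List.Relation.Unary.AllPairs using ([]; _∷_)
open import Data.List.Relation.Unary.Any using (Any; here; there; index; any?)
open import Data.List.Relation.Unary.Unique.Propositional using (Unique)
open import Data.Maybe using (Maybe; just; nothing; maybe′)
open import Data.Maybe.Properties using (just-injective)
open import Data.Nat using (ℕ; suc; _+_; _≤_; s≤s; z≤n; _≟_)
open import Data.Nat.ListAction using (sum)
open import Data.Nat.ListAction.Properties using (sum-↭)
open import Data.Nat.Properties
  using (+-comm; +-suc; +-identityʳ; +-mono-≤; +-monoʳ-≤; m≤m+n; m≤n+m; ≤-reflexive; ≤-trans; <-irrefl)
open import Data.Product using (∃; _×_; _,_; proj₁; proj₂)
open import Data.Sum using (_⊎_; inj₁; inj₂; [_,_]′)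
open import Function using (flip; _∘_; const)
open import Function.Bundles using (mk⇔)
open import Induction.WellFounded using (WellFounded; Acc; acc)
import Induction.WellFounded as WF
open import Level using (0ℓ)
open import Relation.Binary.Construct.Closure.Transitive using (TransClosure; [_]; _∷_; _∷ʳ_)
open import Relation.Binary.Core using (Rel)
open import Relation.Binary.Definitions using (DecidableEquality)
open import Relation.Binary.PropositionalEquality
open ≡-Reasoning
open import Relation.Nullary using (¬_; Dec; yes; no; does; _×-dec_)
import Relation.Nullary.Decidable as Dec

module _ {A : Set} where

  ∈-─ : ∀ {x y} {V : List A} (x∈V : x ∈ V) → y ∈ V → y ≢ x → y ∈ V ─ x∈V
  ∈-─ (here refl) (here refl)  y≢x = ⊥-elim (y≢x refl)
  ∈-─ (here refl) (there y∈V)  y≢x = y∈V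
  ∈-─ (there x∈V) (here refl)  y≢x = here refl
  ∈-─ (there x∈V) (there y∈V)  y≢x = there (∈-─ x∈V y∈V y≢x)

  unique⇒length≤ : ∀ {xs V : List A} → Unique xs → All (_∈ V) xs → length xs ≤ length V
  unique⇒length≤ {[]}     []          []           = z≤n
  unique⇒length≤ {x ∷ xs} {V} (x∉xs ∷ u) (x∈V ∷ xs⊆V) =
    subst (suc (length xs) ≤_) (sym (length-removeAt′ V (index x∈V)))
      (s≤s (unique⇒length≤ u
        (All.zipWith (λ (x≢y , y∈V) → ∈-─ x∈V y∈V (x≢y ∘ sym)) (x∉xs , xs⊆V))))

  flip⁺ : ∀ {_<_ : Rel A 0ℓ} {x y} → TransClosure (flip _<_) x y → TransClosure _<_ y x
  flip⁺ [ y<x ]       = [ y<x ]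
  flip⁺ (y<x ∷ x>⁺z)  = flip⁺ x>⁺z ∷ʳ y<x

  ∈⇒≤sum : ∀ (g : A → ℕ) {a xs} → a ∈ xs → g a ≤ sum (map g xs)
  ∈⇒≤sum g {xs = x ∷ xs} (here refl) = m≤m+n (g x) _
  ∈⇒≤sum g {xs = x ∷ xs} (there a∈xs) = ≤-trans (∈⇒≤sum g a∈xs) (m≤n+m _ (g x))

  distinct⇒+≤sum : ∀ (g : A → ℕ) {a b xs} → Unique xs → a ∈ xs → b ∈ xs → a ≢ b →
                   g a + g b ≤ sum (map g xs)
  distinct⇒+≤sum g _ (here refl) (here refl) a≢b = ⊥-elim (a≢b refl)
  distinct⇒+≤sum g {xs = x ∷ _} _ (here refl) (there b∈xs) _ = +-monoʳ-≤ (g x) (∈⇒≤sum g b∈xs)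
  distinct⇒+≤sum g {a} {xs = x ∷ _} _ (there a∈xs) (here refl) _ =
    ≤-trans (≤-reflexive (+-comm (g a) (g x))) (+-monoʳ-≤ (g x) (∈⇒≤sum g a∈xs))
  distinct⇒+≤sum g {xs = x ∷ _} (_ ∷ u) (there a∈xs) (there b∈xs) a≢b =
    ≤-trans (distinct⇒+≤sum g u a∈xs b∈xs a≢b) (m≤n+m _ (g x))

  sum-cong-set : ∀ (g : A → ℕ) {xs ys} → Unique xs → Unique ys →
                 (∀ {z} → z ∈ xs → z ∈ ys) → (∀ {z} → z ∈ ys → z ∈ xs) →
                 sum (map g xs) ≡ sum (map g ys)
  sum-cong-set g xs! ys! xs⊆ys ys⊆xs =
    sum-↭ (map⁺ g (∼bag⇒↭ (unique∧set⇒bag xs! ys! (mk⇔ xs⊆ys ys⊆xs))))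

module _ {A : Set} {_<_ : Rel A 0ℓ} (V : List A) (<-support : ∀ {x y} → x < y → x ∈ V)
         (<-acyclic : ∀ x → ¬ TransClosure _<_ x x) where

  private
    -- A chain of distinct elements of V is no longer than V, which bounds the fuel k.
    descend : ∀ k {y} (chain : List A) → Unique (y ∷ chain) → All (_∈ V) (y ∷ chain) →
              All (TransClosure _<_ y) chain → length V ≤ k + length chain → Acc _<_ y
    descend 0       chain u chain⊆V _     bound =
      ⊥-elim (<-irrefl refl (≤-trans (unique⇒length≤ u chain⊆V) bound))
    descend (suc k) {y} chain u chain⊆V above bound = acc λ x<y →
      descend k (y ∷ chain) (fresh x<y ∷ u) (<-support x<y ∷ chain⊆V)
        ([ x<y ] ∷ All.map (x<y ∷_) above) (subst (length V ≤_) (sym (+-suc k _)) bound)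
      where
        fresh : ∀ {x} → x < y → All (x ≢_) (y ∷ chain)
        fresh x<y = (λ { refl → <-acyclic _ [ x<y ] })
                  ∷ All.map (λ y<⁺z → λ { refl → <-acyclic _ (x<y ∷ y<⁺z) }) above

  acyclic⇒wellFounded : WellFounded _<_
  acyclic⇒wellFounded y = acc λ x<y →
    descend (length V) [] ([] ∷ []) (<-support x<y ∷ []) [] (≤-reflexive (sym (+-identityʳ _)))

module _ {A : Set} (_≟_ : DecidableEquality A) where

  indicator : A → ℕ → A → ℕ
  indicator a n y = if does (y ≟ a) then n else 0

  sum-indicator-∉ : ∀ {a n} xs → a ∉ xs → sum (map (indicator a n) xs) ≡ 0
  sum-indicator-∉     []       _   = refl
  sum-indicator-∉ {a} (x ∷ xs) a∉ with x ≟ a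
  ... | yes refl = ⊥-elim (a∉ (here refl))
  ... | no  _    = sum-indicator-∉ xs (a∉ ∘ there)

  sum-indicator : ∀ {a n xs} → Unique xs → a ∈ xs → sum (map (indicator a n) xs) ≡ n
  sum-indicator {a} {n} {x ∷ xs} (x∉xs ∷ xs!) a∈ with x ≟ a | a∈
  ... | yes refl | _          =
    trans (cong (n +_) (sum-indicator-∉ xs λ x∈xs → All.lookup x∉xs x∈xs refl)) (+-identityʳ n)
  ... | no  x≢a  | here refl  = ⊥-elim (x≢a refl)
  ... | no  _    | there a∈xs = sum-indicator xs! a∈xs

  indicator-self : ∀ a n → indicator a n a ≡ n
  indicator-self a n with a ≟ a
  ... | yes _   = refl
  ... | no  a≢a = ⊥-elim (a≢a refl)

  source? : ∀ x (L : List (A × A)) → Dec (∃ λ y → (x , y) ∈ L)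
  source? x L = Dec.map′ witness (λ (_ , e∈L) → lose e∈L refl) (any? (λ e → proj₁ e ≟ x) L)
    where
      witness : Any (λ e → proj₁ e ≡ x) L → ∃ λ y → (x , y) ∈ L
      witness a with (_ , y) , e∈L , refl ← find a = y , e∈L

  target? : ∀ y (L : List (A × A)) → Dec (∃ λ x → (x , y) ∈ L)
  target? y L = Dec.map′ witness (λ (_ , e∈L) → lose e∈L refl) (any? (λ e → proj₂ e ≟ y) L)
    where
      witness : Any (λ e → proj₂ e ≡ y) L → ∃ λ x → (x , y) ∈ L
      witness a with (x , _) , e∈L , refl ← find a = x , e∈L

_≟ᴺ_ : DecidableEquality Node
var a   ≟ᴺ var b   = Dec.map′ (cong var) (λ { refl → refl }) (a ≟ b)
var _   ≟ᴺ cst _ _ = no λ ()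
cst _ _ ≟ᴺ var _   = no λ ()
cst k i ≟ᴺ cst l j =
  Dec.map′ (λ (k≡l , i≡j) → cong₂ cst k≡l i≡j) (λ { refl → refl , refl }) (k ≟ l ×-dec i ≟ j)

reach-≈ : ∀ {N m₀ m m'} → Reach N m₀ m → m ≈[ N ] m' → Reach N m₀ m'
reach-≈ (m'' , fires , m''≈m) m≈m' = m'' , fires , λ p p∈ → trans (m''≈m p p∈) (m≈m' p p∈)

module WellFormedTFG {N₁ E N₂ G} (wf : WellFormed N₁ E N₂ G) where
  open WellFormed wf

  _⊏_ : Rel Node 0ℓ
  x ⊏ y = G ⊢ x ⟶ y

  ⊏-source : ∀ {x y} → x ⊏ y → x ∈ nodes G
  ⊏-source (inj₁ x→•y) = proj₁ (R⊆V _ _ x→•y)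
  ⊏-source (inj₂ x∘→y) = proj₁ (A⊆V _ _ x∘→y)

  ⊏-target : ∀ {x y} → x ⊏ y → y ∈ nodes G
  ⊏-target (inj₁ x→•y) = proj₂ (R⊆V _ _ x→•y)
  ⊏-target (inj₂ x∘→y) = proj₂ (A⊆V _ _ x∘→y)

  ⊏-acyclic : ∀ x → ¬ TransClosure _⊏_ x x
  ⊏-acyclic x = T5 x ∘ toPath
    where
      toPath : ∀ {y z} → TransClosure _⊏_ y z → Path⁺ G y z
      toPath [ y⊏z ]       = one y⊏z
      toPath (y⊏w ∷ w⊏⁺z) = cons y⊏w (toPath w⊏⁺z)

  ⊏-wellFounded : WellFounded _⊏_
  ⊏-wellFounded = acyclic⇒wellFounded (nodes G) ⊏-source ⊏-acyclic

  ⊐-wellFounded : WellFounded (flip _⊏_)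
  ⊐-wellFounded = acyclic⇒wellFounded (nodes G) ⊏-target (λ x → ⊏-acyclic x ∘ flip⁺)

  ⊏-var : ∀ {x y} → x ⊏ y → ∃ λ n → y ≡ var n
  ⊏-var {y = var n}   _   = n , refl
  ⊏-var {y = cst k i} x⊏y = ⊥-elim (T2 k i (⊏-target x⊏y) _ x⊏y)

  ∘→-unique : ∀ {p p' y} → G ⊢ p ∘→ y → G ⊢ p' ∘→ y → p ≡ p'
  ∘→-unique p∘→y p'∘→y = T3a _ _ _ p∘→y (inj₂ p'∘→y)

  ∘→-no-→• : ∀ {p r y} → G ⊢ p ∘→ y → G ⊢ r →• y → ⊥
  ∘→-no-→• {p} {r} {y} p∘→y r→•y with T3a p r y p∘→y (inj₁ r→•y)
  ... | refl = T3b p y r→•y p∘→y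

  equation-nodes : ∀ {e} → e ∈ E → lhs e ∈ nodes G × All (_∈ nodes G) (rhs e)
  equation-nodes e∈E with T4E _ e∈E
  ... | nonEmpty , _ , inj₁ isA =
    proj₁ (A⊆V _ _ (proj₁ (isA _) (here refl))) , All.tabulate λ x∈ → proj₂ (A⊆V _ _ (proj₁ (isA _) x∈))
  ... | nonEmpty , _ , inj₂ isR =
    proj₂ (R⊆V _ _ (proj₁ (isR _) (here refl))) , All.tabulate λ x∈ → proj₁ (R⊆V _ _ (proj₁ (isR _) x∈))

  classify : ∀ y → (∃ λ r → G ⊢ r →• y) ⊎ (∃ λ p → G ⊢ p ∘→ y) ⊎ IsRoot G y
  classify y with target? _≟ᴺ_ y (Rarcs G) | target? _≟ᴺ_ y (Aarcs G)
  ... | yes r→•y | _        = inj₁ r→•y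
  ... | no  _    | yes p∘→y = inj₂ (inj₁ p∘→y)
  ... | no  ¬r   | no  ¬p   =
    inj₂ (inj₂ λ { x (inj₁ x→•y) → ¬r (x , x→•y) ; x (inj₂ x∘→y) → ¬p (x , x∘→y) })

  firstChild : Node → Maybe Node
  firstChild p with source? _≟ᴺ_ p (Aarcs G)
  ... | yes (f , _) = just f
  ... | no  _       = nothing

  firstChild-∘→ : ∀ {p f} → firstChild p ≡ just f → G ⊢ p ∘→ f
  firstChild-∘→ {p} fc with source? _≟ᴺ_ p (Aarcs G)
  firstChild-∘→ refl | yes (_ , p∘→f) = p∘→f

  firstChild-just : ∀ {p x} → G ⊢ p ∘→ x → ∃ λ f → firstChild p ≡ just f
  firstChild-just {p} p∘→x with source? _≟ᴺ_ p (Aarcs G)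
  ... | yes (f , _) = f , refl
  ... | no  ¬child  = ⊥-elim (¬child (_ , p∘→x))

  route : Node → ℕ → Node → ℕ
  route p n = maybe′ (λ f → indicator _≟ᴺ_ f n) (const 0) (firstChild p)

  route-firstChild : ∀ {p f} n → firstChild p ≡ just f → route p n ≡ indicator _≟ᴺ_ f n
  route-firstChild n fc = cong (maybe′ (λ f → indicator _≟ᴺ_ f n) (const 0)) fc

  sum-route : ∀ {p xs} n → Unique xs → NonEmpty xs → IsASuccs G p xs → sum (map (route p n) xs) ≡ n
  sum-route n xs! nonEmpty isA with firstChild-just (proj₁ (isA _) (here refl))
  ... | f , fc rewrite route-firstChild n fc = sum-indicator _≟ᴺ_ xs! (proj₂ (isA f) (firstChild-∘→ fc))

  module Drain (s : Valuation) (s-solves : Solves E s) (u : Node) where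

    untouched? : ∀ p n → Dec (p ≢ u × n ≡ val s p)
    untouched? p n = Dec.¬? (p ≟ᴺ u) ×-dec (n ≟ val s p)

    share : Node → ℕ → Node → ℕ
    share p n with untouched? p n
    ... | yes _ = val s
    ... | no  _ = route p n

    rerouteStep : ∀ y → (∀ {z} → z ⊏ y → ℕ) → ℕ
    rerouteStep y rec with classify y
    ... | inj₁ (r , r→•y) with T4R y r r→•y
    ...   | preds , _ , _ , isR = sum (mapWith∈ preds λ z∈ → rec (inj₁ (proj₁ (isR _) z∈)))
    rerouteStep y rec | inj₂ (inj₁ (p , p∘→y)) = share p (rec (inj₂ p∘→y)) y
    rerouteStep y rec | inj₂ (inj₂ _)          = val s y

    rerouteStep-ext : ∀ y {rec rec′ : ∀ {z} → z ⊏ y → ℕ} →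
                      (∀ {z} (z⊏y : z ⊏ y) → rec z⊏y ≡ rec′ z⊏y) → rerouteStep y rec ≡ rerouteStep y rec′
    rerouteStep-ext y rec≗rec′ with classify y
    ... | inj₁ (r , r→•y) with T4R y r r→•y
    ...   | preds , _ , _ , _ = cong sum (mapWith∈-cong preds _ _ λ _ → rec≗rec′ _)
    rerouteStep-ext y rec≗rec′ | inj₂ (inj₁ (p , _)) = cong (λ n → share p n y) (rec≗rec′ _)
    rerouteStep-ext y rec≗rec′ | inj₂ (inj₂ _)       = refl

    reroute : Node → ℕ
    reroute = WF.All.wfRec ⊏-wellFounded 0ℓ (λ _ → ℕ) rerouteStep

    reroute-unfold : ∀ {y} → reroute y ≡ rerouteStep y (λ _ → reroute _)
    reroute-unfold = WF.FixPoint.unfold-wfRec ⊏-wellFounded (λ _ → ℕ) rerouteStep rerouteStep-ext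

    reroute-→• : ∀ {r y xs} → G ⊢ r →• y → Unique xs → IsRPreds G y xs →
                 reroute y ≡ sum (map reroute xs)
    reroute-→• {y = y} {xs} r→•y xs! isR′ rewrite reroute-unfold {y} with classify y
    ... | inj₁ (r , r→•y′) with T4R y r r→•y′
    ...   | preds , _ , preds! , isR =
      trans (cong sum (mapWith∈≗map reroute preds))
            (sum-cong-set reroute preds! xs! (λ z∈ → proj₂ (isR′ _) (proj₁ (isR _) z∈))
                                             (λ z∈ → proj₂ (isR _) (proj₁ (isR′ _) z∈)))
    reroute-→• r→•y _ _ | inj₂ (inj₁ (_ , p∘→y)) = ⊥-elim (∘→-no-→• p∘→y r→•y)
    reroute-→• r→•y _ _ | inj₂ (inj₂ root)       = ⊥-elim (root _ (inj₁ r→•y))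

    reroute-∘→ : ∀ {p y} → G ⊢ p ∘→ y → reroute y ≡ share p (reroute p) y
    reroute-∘→ {y = y} p∘→y rewrite reroute-unfold {y} with classify y
    ... | inj₁ (_ , r→•y) = ⊥-elim (∘→-no-→• p∘→y r→•y)
    ... | inj₂ (inj₁ (p′ , p′∘→y)) with ∘→-unique p∘→y p′∘→y
    ...   | refl = refl
    reroute-∘→ p∘→y | inj₂ (inj₂ root) = ⊥-elim (root _ (inj₂ p∘→y))

    reroute-root : ∀ {y} → IsRoot G y → reroute y ≡ val s y
    reroute-root {y} root rewrite reroute-unfold {y} with classify y
    ... | inj₁ (r , r→•y)        = ⊥-elim (root r (inj₁ r→•y))
    ... | inj₂ (inj₁ (p , p∘→y)) = ⊥-elim (root p (inj₂ p∘→y))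
    ... | inj₂ (inj₂ _)          = refl

    share-untouched : ∀ {p} y → p ≢ u → share p (val s p) y ≡ val s y
    share-untouched {p} y p≢u with untouched? p (val s p)
    ... | yes _          = refl
    ... | no  ¬untouched = ⊥-elim (¬untouched (p≢u , refl))

    share-drained : ∀ n y → share u n y ≡ route u n y
    share-drained n y with untouched? u n
    ... | yes (u≢u , _) = ⊥-elim (u≢u refl)
    ... | no  _         = refl

    sum-share : ∀ {p xs} n → (p ≐ xs) ∈ E → Unique xs → NonEmpty xs → IsASuccs G p xs →
                sum (map (share p n) xs) ≡ n
    sum-share {p} n p≐xs xs! xs≠[] isA with untouched? p n
    ... | yes (_ , refl) = sym (s-solves _ p≐xs)
    ... | no  _          = sum-route n xs! xs≠[] isA

    _◅_ : ∀ {z x} → z ⊏ x → x ≡ u ⊎ TransClosure _⊏_ x u → TransClosure _⊏_ z u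
    z⊏x ◅ inj₁ refl = [ z⊏x ]
    z⊏x ◅ inj₂ x⊏⁺u = z⊏x ∷ x⊏⁺u

    reroute-ancestor : ∀ {x} → Acc _⊏_ x → x ≡ u ⊎ TransClosure _⊏_ x u → reroute x ≡ val s x
    reroute-ancestor {x} (acc rs) x≼u = [ via-→• , [ via-∘→ , reroute-root ]′ ]′ (classify x)
      where
        via-→• : (∃ λ r → G ⊢ r →• x) → reroute x ≡ val s x
        via-→• (r , r→•x) with T4R x r r→•x
        ... | xs , x≐xs , xs! , isR = begin
          reroute x             ≡⟨ reroute-→• r→•x xs! isR ⟩
          sum (map reroute xs)  ≡⟨ cong sum (map-cong-local (All.tabulate λ z∈ →
                                     reroute-ancestor (rs (inj₁ (arc z∈))) (inj₂ (inj₁ (arc z∈) ◅ x≼u)))) ⟩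
          sum (map (val s) xs)  ≡⟨ sym (s-solves _ x≐xs) ⟩
          val s x               ∎
          where
            arc : ∀ {z} → z ∈ xs → G ⊢ z →• x
            arc = proj₁ (isR _)

        via-∘→ : (∃ λ p → G ⊢ p ∘→ x) → reroute x ≡ val s x
        via-∘→ (p , p∘→x) = begin
          reroute x              ≡⟨ reroute-∘→ p∘→x ⟩
          share p (reroute p) x  ≡⟨ cong (λ n → share p n x)
                                      (reroute-ancestor (rs (inj₂ p∘→x)) (inj₂ p⊏⁺u)) ⟩
          share p (val s p) x    ≡⟨ share-untouched {p} x (λ { refl → ⊏-acyclic p p⊏⁺u }) ⟩
          val s x                ∎
          where p⊏⁺u = inj₂ p∘→x ◅ x≼u

    drained : Valuation
    drained n = reroute (var n)

    val-drained : ∀ {x} → x ∈ nodes G → val drained x ≡ reroute x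
    val-drained {var _}   _   = refl
    val-drained {cst k i} x∈G = sym (reroute-root (T2 k i x∈G))

    drained-solves : Solves E drained
    drained-solves (l ≐ xs) l≐xs = begin
      val drained l                ≡⟨ val-drained l∈G ⟩
      reroute l                    ≡⟨ conserved (T4E _ l≐xs) ⟩
      sum (map reroute xs)         ≡⟨ cong sum (map-cong-local (All.map (sym ∘ val-drained) xs⊆G)) ⟩
      sum (map (val drained) xs)   ∎
      where
        l∈G = proj₁ (equation-nodes l≐xs)
        xs⊆G = proj₂ (equation-nodes l≐xs)
        conserved : NonEmpty xs × Unique xs × (IsASuccs G l xs ⊎ IsRPreds G l xs) →
                    reroute l ≡ sum (map reroute xs)
        conserved (xs≠[] , xs! , inj₁ isA) = begin
          reroute l                               ≡⟨ sym (sum-share _ l≐xs xs! xs≠[] isA) ⟩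
          sum (map (share l (reroute l)) xs)      ≡⟨ cong sum (map-cong-local (All.tabulate λ y∈ →
                                                       sym (reroute-∘→ (proj₁ (isA _) y∈)))) ⟩
          sum (map reroute xs)                    ∎
        conserved (nonEmpty , xs! , inj₂ isR) = reroute-→• (proj₁ (isR _) (here refl)) xs! isR

    drained-≈ : s ≈[ N₂ ] drained
    drained-≈ p p∈N₂ = sym (reroute-root (proj₂ (proj₂ (T6root p) p∈N₂)))

    drained-firstChild : ∀ {f} → firstChild u ≡ just f → reroute f ≡ val s u
    drained-firstChild {f} fc = begin
      reroute f                          ≡⟨ reroute-∘→ (firstChild-∘→ fc) ⟩
      share u (reroute u) f              ≡⟨ share-drained (reroute u) f ⟩
      route u (reroute u) f              ≡⟨ cong (λ g → g f) (route-firstChild (reroute u) fc) ⟩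
      indicator _≟ᴺ_ f (reroute u) f     ≡⟨ indicator-self _≟ᴺ_ f (reroute u) ⟩
      reroute u                          ≡⟨ reroute-ancestor (⊏-wellFounded u) (inj₁ refl) ⟩
      val s u                            ∎

  module _ {c : Config} (c-config : IsConfig G c) (c-total : Total G c) (c-wd : WellDefined G c) where
    open WellDefined c-wd

    config-val : ∀ {x} → x ∈ nodes G → c x ≡ just (val (restrict c) x)
    config-val {var n}   x∈G with c (var n) | c-total _ x∈G
    ... | just _  | _       = refl
    ... | nothing | c≢nothing = ⊥-elim (c≢nothing refl)
    config-val {cst k i} x∈G = c-config k i x∈G

    sumC-val : ∀ {xs} → All (_∈ nodes G) xs → sumC c xs ≡ just (sum (map (val (restrict c)) xs))
    sumC-val []                      = refl
    sumC-val (x∈G ∷ xs⊆G) rewrite config-val x∈G | sumC-val xs⊆G = refl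

    config-solves : Solves E (restrict c)
    config-solves (l ≐ xs) l≐xs with T4E _ l≐xs | equation-nodes l≐xs
    ... | xs≠[] , xs! , isA⊎isR | l∈G , xs⊆G = just-injective (begin
      just (val (restrict c) l)  ≡⟨ sym (CEq isA⊎isR) ⟩
      sumC c xs                  ≡⟨ sumC-val xs⊆G ⟩
      just _                     ∎)
      where
        CEq : IsASuccs G l xs ⊎ IsRPreds G l xs → sumC c xs ≡ just (val (restrict c) l)
        CEq (inj₁ isA) = CEqA l _ xs (config-val l∈G) xs≠[] xs! isA
        CEq (inj₂ isR) = CEqR l _ xs (config-val l∈G) xs≠[] xs! isR

    positive⇒1≤ : ∀ {x} → x ∈ nodes G → Positive c x → 1 ≤ val (restrict c) x
    positive⇒1≤ x∈G (k , cx≡) = subst (1 ≤_) (just-injective (trans (sym cx≡) (config-val x∈G))) (s≤s z≤n)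

  firstChild-nothing : ∀ {p} → firstChild p ≡ nothing → IsALeaf G p
  firstChild-nothing fc _ p∘→y with firstChild-just p∘→y
  ... | _ , fc′ with () ← trans (sym fc) fc′

  sibling-equation : ∀ {v w w'} → (G ⊢ v ∘→ w × G ⊢ v ∘→ w') ⊎ (G ⊢ w →• v × G ⊢ w' →• v) →
                     ∃ λ xs → (v ≐ xs) ∈ E × Unique xs × w ∈ xs × w' ∈ xs
  sibling-equation {v} {w} {w'} (inj₁ (v∘→w , v∘→w')) with T4A v w v∘→w
  ... | xs , v≐xs , xs! , isA = xs , v≐xs , xs! , proj₂ (isA w) v∘→w , proj₂ (isA w') v∘→w'
  sibling-equation {v} {w} {w'} (inj₂ (w→•v , w'→•v)) with T4R v w w→•v
  ... | xs , v≐xs , xs! , isR = xs , v≐xs , xs! , proj₂ (isR w) w→•v , proj₂ (isR w') w'→•v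

module _ {N₁ m₁ E N₂ m₂ G} (equiv : Equiv N₁ m₁ E N₂ m₂) (safe₁ : Safe N₁ m₁)
         (wf : WellFormed N₁ E N₂ G) where
  open WellFormed wf
  open WellFormedTFG wf
  open Equiv equiv

  place-≤1 : ∀ {s n} → Solves E s → Reach N₂ m₂ s → n ∈ places N₁ → s n ≤ 1
  place-≤1 {s} s-solves reach n∈N₁ =
    safe₁ s (proj₂ (A3 s s (s , s-solves , (λ _ _ → refl) , (λ _ _ → refl))) reach) _ n∈N₁

  -- The hypothesis on x excludes constant A-leaves, which may carry any value.
  solution-≤1 : ∀ {x} → Acc (flip _⊏_) x → ∀ s → Solves E s → Reach N₂ m₂ s → x ∈ nodes G →
                (∃ λ n → x ≡ var n) ⊎ (∃ λ y → G ⊢ x ∘→ y) → val s x ≤ 1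
  solution-≤1 {x} (acc rs) s s-solves reach x∈G x-shape with firstChild x in fc
  ... | just f = ≤-trans (≤-reflexive (trans (sym (drained-firstChild fc)) (sym (val-drained f∈G))))
                   (solution-≤1 (rs x⊏f) drained drained-solves (reach-≈ reach drained-≈) f∈G
                                (inj₁ (⊏-var x⊏f)))
    where
      open Drain s s-solves x
      x⊏f = inj₂ (firstChild-∘→ fc)
      f∈G = ⊏-target x⊏f
  ... | nothing with x-shape
  ...   | inj₁ (n , refl)  = place-≤1 s-solves reach (proj₁ (T6leaf n) (x∈G , firstChild-nothing fc))
  ...   | inj₂ (_ , x∘→y) = ⊥-elim (firstChild-nothing fc _ x∘→y)

lemma12 : (N₁ : Net) (m₁ : Marking) (E : LinSys) (N₂ : Net) (m₂ : Marking)
    (G : TFG) →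
    Equiv N₁ m₁ E N₂ m₂ → Safe N₁ m₁ → Safe N₂ m₂ →
    WellFormed N₁ E N₂ G →
    (v w w' : Node) → v ∈ nodes G →
    ((G ⊢ v ∘→ w × G ⊢ v ∘→ w') ⊎ (G ⊢ w →• v × G ⊢ w' →• v)) →
    w ≢ w' → ¬ Conc G N₂ m₂ w w'
lemma12 N₁ m₁ E N₂ m₂ G equiv safe₁ _ wf v w w' v∈G siblings w≢w'
        (c , c-config , c-total , c-wd , reach , w>0 , w'>0) = <-irrefl refl (≤-trans 2≤v v≤1)
  where
    open WellFormedTFG wf
    s = restrict c
    s-solves = config-solves c-config c-total c-wd

    2≤v : 2 ≤ val s v
    2≤v with sibling-equation siblings
    ... | xs , v≐xs , xs! , w∈xs , w'∈xs =
      subst (2 ≤_) (sym (s-solves _ v≐xs))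
        (≤-trans (+-mono-≤ (1≤ w∈xs w>0) (1≤ w'∈xs w'>0)) (distinct⇒+≤sum (val s) xs! w∈xs w'∈xs w≢w'))
      where
        1≤ : ∀ {x} → x ∈ xs → Positive c x → 1 ≤ val s x
        1≤ x∈xs = positive⇒1≤ c-config c-total c-wd (All.lookup (proj₂ (equation-nodes v≐xs)) x∈xs)

    v-shape : (∃ λ n → v ≡ var n) ⊎ (∃ λ y → G ⊢ v ∘→ y)
    v-shape = [ (λ (v∘→w , _) → inj₂ (w , v∘→w)) , (λ (w→•v , _) → inj₁ (⊏-var (inj₁ w→•v))) ]′
                siblings

    v≤1 : val s v ≤ 1
    v≤1 = solution-≤1 equiv safe₁ wf (⊐-wellFounded v) s s-solves reach v∈G v-shape
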